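{- Let $I$ be an instance of Subset Sum with multiplicities with items $i\in[n]$ of positive integer sizes $s_i$ and multiplicities $u_i$, target $t$, and $s=\max_i s_i$. Let $k=\lfloor s^{1/3}\rfloor$, $u^{\uparrow}_i=\max\{0,\lfloor u_i/k\rfloor-8\}$ and $u^{\downarrow}_i=u_i-k\,u^{\uparrow}_i$. Let $p\in\mathbb{N}^n$ be a maximal prefix solution and let $p^{\uparrow},p^{\downarrow}$ be its robust split. If $t\in\mathcal{S}(I)$, then there exist integer vectors $x^{\uparrow},x^{\downarrow}$ with $0\le x^{\uparrow}_i\le u^{\uparrow}_i$ and $0\le x^{\downarrow}_i\le u^{\downarrow}_i$ for all $i$, such that $$\sum_{i\in[n]}(k x^{\uparrow}_i+x^{\downarrow}_i)s_i=t\qquad\text{and}\qquad \|x^{\uparrow}-p^{\uparrow}\|_1\le\mathcal{O}(s/k).$$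
   Context: $\mathcal{S}(I)$ is the set of values $\sum_i s_i x_i$ over integers $0\le x_i\le u_i$. A maximal prefix solution (for the Knapsack view of the instance with values $v_i=s_i$ and capacity $t$) is obtained by ordering items by efficiency $v_i/s_i$ (ties broken arbitrarily) and, starting from the most efficient, adding copies of items in this order until adding the next copy would exceed $t$; $p_i$ is the number of copies of item $i$ selected. The robust split of $p$ is defined by $p^{\uparrow}_i=0$ if $p_i\le 4k$ or $u_i\le 8k$; $p^{\uparrow}_i=\lfloor u_i/k\rfloor-8$ if $p_i\ge u_i-4k$ and $u_i>8k$; $p^{\uparrow}_i=\lfloor p_i/k\rfloor-2$ if $4k<p_i<u_i-4k$ and $u_i>8k$; and $p^{\downarrow}_i=p_i-k p^{\uparrow}_i$. $\|y\|_1=\sum_i|y_i|$. -}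

module Defs where

open import Data.Nat using (ℕ; zero; suc; _+_; _*_; _∸_; _^_; _≤_; _<_; _⊔_; _≤ᵇ_; _≤?_; _/_)
open import Data.Fin using (Fin; _≟_)
open import Data.List using (List; []; _∷_)
open import Data.Bool using (if_then_else_)
open import Relation.Nullary using (yes; no)

sumF : ∀ {n} → (Fin n → ℕ) → ℕ
sumF {zero}  f = 0
sumF {suc n} f = f Fin.zero + sumF (λ i → f (Fin.suc i))

maxF : ∀ {n} → (Fin n → ℕ) → ℕ
maxF {zero}  f = 0
maxF {suc n} f = f Fin.zero ⊔ maxF (λ i → f (Fin.suc i))

-- Floor of the cube root: cbrt m = largest r with r^3 ≤ m
cbrt : ℕ → ℕ
cbrt zero = 0
cbrt (suc m) = if (suc (cbrt m)) ^ 3 ≤ᵇ suc m then suc (cbrt m) else cbrt m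

-- Floor division, with the (never used in our setting) convention m div 0 = 0
_div_ : ℕ → ℕ → ℕ
m div zero = 0
m div suc k = m / suc k

InSubsetSums : ∀ {n} → (Fin n → ℕ) → (Fin n → ℕ) → ℕ → Set
InSubsetSums {n} s u t =
  Σ (Fin n → ℕ) λ x → ((i : Fin n) → x i ≤ u i) × sumF (λ i → s i * x i) ≡ t
  where open import Data.Product using (Σ; _×_)
        open import Relation.Binary.PropositionalEquality using (_≡_)

-- Maximal prefix solution for the item order σ (a list of items), with
-- remaining capacity r: items are taken fully while they fit; the first item
-- that does not fit fully gets ⌊r / s_i⌋ copies; all later items get 0.
-- (All efficiencies v_i/s_i equal 1, so every order is a valid tie-break.)
prefixSol : ∀ {n} → (Fin n → ℕ) → (Fin n → ℕ) → ℕ → List (Fin n) → Fin n → ℕ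
prefixSol s u r [] j = 0
prefixSol s u r (i ∷ σ) j with u i * s i ≤? r | j ≟ i
... | yes _ | yes _ = u i
... | yes _ | no  _ = prefixSol s u (r ∸ u i * s i) σ j
... | no  _ | yes _ = r div s i
... | no  _ | no  _ = 0

robustUp : ℕ → ℕ → ℕ → ℕ
robustUp k u p with p ≤? 4 * k | u ≤? 8 * k
... | yes _ | _     = 0
... | no  _ | yes _ = 0
... | no  _ | no  _ with u ∸ 4 * k ≤? p
...   | yes _ = (u div k) ∸ 8
...   | no  _ = (p div k) ∸ 2

robustDown : ℕ → ℕ → ℕ → ℕ
robustDown k u p = p ∸ k * robustUp k u p

uUp : ℕ → ℕ → ℕ
uUp k u = (u div k) ∸ 8

uDown : ℕ → ℕ → ℕ
uDown k u = u ∸ k * uUp k u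

-- Write S for the largest size and K for the rounding unit (any 1 ≤ K ≤ S, in particular ⌊S^(1/3)⌋).
--
-- Some solution x′ lies within ℓ₁-distance 2S of the prefix solution p.  Write x′ = p + e − d; as
-- w(p) ≤ t and p is maximal, the weight w satisfies w(d) ≤ w(e) ≤ w(d) + S.  Adding the items of e
-- and d one at a time, from e while its partial weight is not ahead and from d otherwise, keeps the
-- difference of the two partial weights in a window of 2S values.  So if ‖e‖₁ + ‖d‖₁ ≥ 2S, two of
-- the first 2S + 1 partial selections have the same difference, and the items added between them form
-- parts of e and d of equal weight, which can be cancelled to bring x′ closer to p.
--
-- Then x↑ = min(u↑, ⌊x′/K⌋) and x↓ = x′ − K x↑ respect the multiplicities, and
-- K |x↑ᵢ − p↑ᵢ| ≤ |x′ᵢ − pᵢ| + 5K.  When pᵢ = 0 or pᵢ = uᵢ the rounding is exact unless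
-- |x′ᵢ − pᵢ| ≥ K, so only the single partially filled item of p pays the additive 5K, and
-- K ‖x↑ − p↑‖₁ ≤ 6 · 2S + 5K ≤ 17 S.

module Submission where

open import Defs
open import Data.Nat
  using (ℕ; zero; suc; _+_; _*_; _∸_; _^_; _≤_; _<_; _⊓_; z≤n; s≤s; s≤s⁻¹; _≟_; _≤?_; _<?_; _≤ᵇ_; _/_; _%_; ∣_-_∣; >-nonZero)
open import Data.Nat.Properties
open import Data.Nat.DivMod using (m≡m%n+[m/n]*n; m%n<n; m<n*o⇒m/o<n; m/n*n≤m; m*n/n≡m; /-monoˡ-≤; m<n⇒m/n≡0)
open import Data.Nat.Tactic.RingSolver using (solve-∀)
open import Data.Bool using (true; false)
open import Data.Fin using (Fin; toℕ; fromℕ<) renaming (_≟_ to _≟ᶠ_)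
open import Data.Fin.Properties using (any?; pigeonhole; toℕ-fromℕ<; toℕ≤pred[n])
  renaming (suc-injective to suc-injectiveᶠ)
open import Data.List using (List; []; _∷_)
open import Data.List.Base using (allFin)
open import Data.List.Membership.Propositional using (_∈_; _∉_)
open import Data.List.Membership.Propositional.Properties using (∈-allFin)
open import Data.List.Relation.Unary.Any using (here; there)
open import Data.List.Relation.Unary.Unique.Propositional using (Unique; _∷_)
open import Data.List.Relation.Unary.Unique.Propositional.Properties using (Unique[x∷xs]⇒x∉xs; allFin⁺)
open import Data.List.Relation.Binary.Permutation.Propositional using (_↭_; ↭-sym; ↭⇒↭ₛ)
open import Data.List.Relation.Binary.Permutation.Propositional.Properties using (∈-resp-↭)
open import Data.List.Relation.Binary.Permutation.Setoid.Properties using (Unique-resp-↭)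
open import Data.Product using (Σ; ∃; _×_; _,_; proj₁; proj₂)
open import Data.Sum using (_⊎_; inj₁; inj₂)
open import Data.Vec.Functional using (Vector; updateAt)
open import Data.Vec.Functional.Properties using (updateAt-updates; updateAt-minimal)
open import Function using (_∘_)
open import Relation.Binary.PropositionalEquality
open import Relation.Nullary using (¬_; Dec; yes; no; contradiction)
open import Algebra.Properties.Semiring.Sum +-*-semiring
  using (sum; sum-cong-≗; sum-replicate-zero; ∑-distrib-+; *-distribˡ-sum; *-distribʳ-sum)
open import Algebra.Properties.CommutativeSemigroup +-commutativeSemigroup
  using (interchange; x∙yz≈y∙xz; x∙yz≈xz∙y; xy∙z≈xz∙y)

∣-∣≤ : ∀ {a b c} → a ≤ b + c → b ≤ a + c → ∣ a - b ∣ ≤ c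
∣-∣≤ {a} {b} a≤b+c b≤a+c with ∣m-n∣≡[m∸n]∨[n∸m] a b
... | inj₁ eq = subst (_≤ _) (sym eq) (m≤n+o⇒m∸n≤o a b a≤b+c)
... | inj₂ eq = subst (_≤ _) (sym eq) (m≤n+o⇒m∸n≤o b a b≤a+c)

∣⊓-⊓∣≤∣-∣ : ∀ m x y → ∣ m ⊓ x - m ⊓ y ∣ ≤ ∣ x - y ∣
∣⊓-⊓∣≤∣-∣ m x y = ∣-∣≤ (⊓≤⊓+∣-∣ x y) (subst (λ d → m ⊓ y ≤ m ⊓ x + d) (∣-∣-comm y x) (⊓≤⊓+∣-∣ y x))
  where
  ⊓≤⊓+∣-∣ : ∀ x y → m ⊓ x ≤ m ⊓ y + ∣ x - y ∣
  ⊓≤⊓+∣-∣ x y = subst (m ⊓ x ≤_) (sym (+-distribʳ-⊓ ∣ x - y ∣ m y))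
    (⊓-glb (≤-trans (m⊓n≤m m x) (m≤m+n m _)) (≤-trans (m⊓n≤n m x) (m≤n+∣m-n∣ x y)))

m+[n∸m]≡n+[m∸n] : ∀ m n → m + (n ∸ m) ≡ n + (m ∸ n)
m+[n∸m]≡n+[m∸n] m n with ≤-total m n
... | inj₁ m≤n = trans (m+[n∸m]≡n m≤n) (sym (trans (cong (n +_) (m≤n⇒m∸n≡0 m≤n)) (+-identityʳ n)))
... | inj₂ n≤m = trans (trans (cong (m +_) (m≤n⇒m∸n≡0 n≤m)) (+-identityʳ m)) (sym (m+[n∸m]≡n n≤m))

m+[n∸m]≤o : ∀ {m n o} → m ≤ o → n ≤ o → m + (n ∸ m) ≤ o
m+[n∸m]≤o {m} {n} m≤o n≤o with ≤-total m n
... | inj₁ m≤n = subst (_≤ _) (sym (m+[n∸m]≡n m≤n)) n≤o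
... | inj₂ n≤m = subst (_≤ _) (sym (trans (cong (m +_) (m≤n⇒m∸n≡0 n≤m)) (+-identityʳ m))) m≤o

div-< : ∀ {r a b} → 1 ≤ b → r < a * b → r div b < a
div-< {b = suc b} _ = m<n*o⇒m/o<n

*-div-≤ : ∀ r {b} → 1 ≤ b → b * (r div b) ≤ r
*-div-≤ r {suc b} _ = subst (_≤ r) (*-comm (r / suc b) (suc b)) (m/n*n≤m r (suc b))

<-*-div-+ : ∀ r {b} → 1 ≤ b → r < b * (r div b) + b
<-*-div-+ r {suc b} _ = begin-strict
  r                             ≡⟨ m≡m%n+[m/n]*n r (suc b) ⟩
  r % suc b + r / suc b * suc b <⟨ +-monoˡ-< _ (m%n<n r (suc b)) ⟩
  suc b + r / suc b * suc b     ≡⟨ +-comm (suc b) _ ⟩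
  r / suc b * suc b + suc b     ≡⟨ cong (_+ suc b) (*-comm (r / suc b) (suc b)) ⟩
  suc b * (r / suc b) + suc b   ∎
  where open ≤-Reasoning

_≤ᵥ_ : ∀ {n} → Vector ℕ n → Vector ℕ n → Set
f ≤ᵥ g = ∀ i → f i ≤ g i

≤ᵥ-trans : ∀ {n} {f g h : Vector ℕ n} → f ≤ᵥ g → g ≤ᵥ h → f ≤ᵥ h
≤ᵥ-trans f≤g g≤h i = ≤-trans (f≤g i) (g≤h i)

≤ᵥ⇒<⊎≗ : ∀ {n} {f g : Vector ℕ n} → f ≤ᵥ g → (∃ λ i → f i < g i) ⊎ (∀ i → f i ≡ g i)
≤ᵥ⇒<⊎≗ {f = f} {g} f≤g with any? (λ i → f i <? g i)
... | yes f<g = inj₁ f<g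
... | no  f≮g = inj₂ λ i → ≤-antisym (f≤g i) (≮⇒≥ (f≮g ∘ (i ,_)))

updateAt-suc-≤ᵥ : ∀ {n} {f g : Vector ℕ n} i → f ≤ᵥ g → f i < g i → updateAt f i suc ≤ᵥ g
updateAt-suc-≤ᵥ {f = f} {g} i f≤g fi<gi j with j ≟ᶠ i
... | yes refl = subst (_≤ g j) (sym (updateAt-updates j f)) fi<gi
... | no  j≢i  = subst (_≤ g j) (sym (updateAt-minimal j i f j≢i)) (f≤g j)

≤ᵥ-updateAt-suc : ∀ {n} (f : Vector ℕ n) i → f ≤ᵥ updateAt f i suc
≤ᵥ-updateAt-suc f i j with j ≟ᶠ i
... | yes refl = subst (f j ≤_) (sym (updateAt-updates j f)) (n≤1+n (f j))
... | no  j≢i  = ≤-reflexive (sym (updateAt-minimal j i f j≢i))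

sumF≡sum : ∀ {n} (f : Vector ℕ n) → sumF f ≡ sum f
sumF≡sum {zero}  f = refl
sumF≡sum {suc n} f = cong (f Fin.zero +_) (sumF≡sum (λ i → f (Fin.suc i)))

sum-mono-≤ : ∀ {n} {f g : Vector ℕ n} → f ≤ᵥ g → sum f ≤ sum g
sum-mono-≤ {zero}  f≤g = z≤n
sum-mono-≤ {suc n} f≤g = +-mono-≤ (f≤g Fin.zero) (sum-mono-≤ (λ i → f≤g (Fin.suc i)))

sum-mono-< : ∀ {n} {f g : Vector ℕ n} (j : Fin n) →
             f ≤ᵥ g → f j < g j → sum f < sum g
sum-mono-< Fin.zero    f≤g fj<gj = +-mono-<-≤ fj<gj (sum-mono-≤ (λ i → f≤g (Fin.suc i)))
sum-mono-< (Fin.suc j) f≤g fj<gj =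
  +-mono-≤-< (f≤g Fin.zero) (sum-mono-< j (λ i → f≤g (Fin.suc i)) fj<gj)

sum-agree-except : ∀ {n} {f g : Vector ℕ n} (i : Fin n) →
                   (∀ j → j ≢ i → f j ≡ g j) → sum f + g i ≡ sum g + f i
sum-agree-except {suc n} {f} {g} Fin.zero f≗g
  rewrite sum-cong-≗ {x = λ j → f (Fin.suc j)} (λ j → f≗g (Fin.suc j) λ ())
  = swap (f Fin.zero) _ (g Fin.zero)
  where
  swap : ∀ a b c → a + b + c ≡ c + b + a
  swap = solve-∀
sum-agree-except {suc n} {f} {g} (Fin.suc i) f≗g
  rewrite f≗g Fin.zero (λ ())
        | +-assoc (g Fin.zero) (sum (λ j → f (Fin.suc j))) (g (Fin.suc i))
        | +-assoc (g Fin.zero) (sum (λ j → g (Fin.suc j))) (f (Fin.suc i))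
  = cong (g Fin.zero +_) (sum-agree-except i (λ j j≢i → f≗g (Fin.suc j) (j≢i ∘ suc-injectiveᶠ)))

weight : ∀ {n} → Vector ℕ n → Vector ℕ n → ℕ
weight s f = sum (λ i → s i * f i)

module _ {n : ℕ} (s : Vector ℕ n) where

  weight-zero : weight s (λ _ → 0) ≡ 0
  weight-zero = trans (sum-cong-≗ (λ i → *-zeroʳ (s i))) (sum-replicate-zero n)

  weight-+ : ∀ f g → weight s (λ i → f i + g i) ≡ weight s f + weight s g
  weight-+ f g = trans (sum-cong-≗ (λ i → *-distribˡ-+ (s i) (f i) (g i)))
                       (∑-distrib-+ (λ i → s i * f i) (λ i → s i * g i))

  weight-∸ : ∀ {f g} → f ≤ᵥ g → weight s (λ i → g i ∸ f i) + weight s f ≡ weight s g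
  weight-∸ {f} {g} f≤g = trans (sym (weight-+ (λ i → g i ∸ f i) f)) (sum-cong-≗ λ i → cong (s i *_) (m∸n+n≡m (f≤g i)))

  weight-mono-≤ : ∀ {f g} → f ≤ᵥ g → weight s f ≤ weight s g
  weight-mono-≤ f≤g = sum-mono-≤ (λ i → *-monoʳ-≤ (s i) (f≤g i))

  weight-updateAt-suc : ∀ f i → weight s (updateAt f i suc) ≡ weight s f + s i
  weight-updateAt-suc f i = +-cancelʳ-≡ (s i * f i) _ _ (begin
    weight s (updateAt f i suc) + s i * f i ≡⟨ sum-agree-except i (λ j j≢i → cong (s j *_) (updateAt-minimal j i f j≢i)) ⟩
    weight s f + s i * updateAt f i suc i   ≡⟨ cong (λ v → weight s f + s i * v) (updateAt-updates i f) ⟩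
    weight s f + s i * suc (f i)            ≡⟨ cong (weight s f +_) (*-suc (s i) (f i)) ⟩
    weight s f + (s i + s i * f i)          ≡⟨ +-assoc (weight s f) (s i) _ ⟨
    weight s f + s i + s i * f i            ∎)
    where open ≡-Reasoning

weight-mono-< : ∀ {n} {s f g : Vector ℕ n} → (∀ i → 1 ≤ s i) →
                f ≤ᵥ g → ∀ j → f j < g j → weight s f < weight s g
weight-mono-< {s = s} s>0 f≤g j fj<gj =
  sum-mono-< j (λ i → *-monoʳ-≤ (s i) (f≤g i)) (*-monoʳ-< (s j) {{>-nonZero (s>0 j)}} fj<gj)

sum≡weight1 : ∀ {n} (f : Vector ℕ n) → sum f ≡ weight (λ _ → 1) f
sum≡weight1 f = sum-cong-≗ (λ i → sym (*-identityˡ (f i)))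

sum-updateAt-suc : ∀ {n} (f : Vector ℕ n) i → sum (updateAt f i suc) ≡ suc (sum f)
sum-updateAt-suc f i = begin
  sum (updateAt f i suc)                  ≡⟨ sum≡weight1 (updateAt f i suc) ⟩
  weight (λ _ → 1) (updateAt f i suc)     ≡⟨ weight-updateAt-suc (λ _ → 1) f i ⟩
  weight (λ _ → 1) f + 1                  ≡⟨ cong (_+ 1) (sum≡weight1 f) ⟨
  sum f + 1                               ≡⟨ +-comm (sum f) 1 ⟩
  suc (sum f)                             ∎
  where open ≡-Reasoning

sum-∸ : ∀ {n} {f g : Vector ℕ n} → f ≤ᵥ g → sum (λ i → g i ∸ f i) + sum f ≡ sum g
sum-∸ {f = f} {g} f≤g = begin
  sum (λ i → g i ∸ f i) + sum f                           ≡⟨ cong₂ _+_ (sum≡weight1 (λ i → g i ∸ f i)) (sum≡weight1 f) ⟩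
  weight (λ _ → 1) (λ i → g i ∸ f i) + weight (λ _ → 1) f ≡⟨ weight-∸ (λ _ → 1) f≤g ⟩
  weight (λ _ → 1) g                                      ≡⟨ sum≡weight1 g ⟨
  sum g                                                   ∎
  where open ≡-Reasoning

≤maxF : ∀ {n} (f : Vector ℕ n) i → f i ≤ maxF f
≤maxF f Fin.zero    = m≤m⊔n _ _
≤maxF f (Fin.suc i) = ≤-trans (≤maxF (λ j → f (Fin.suc j)) i) (m≤n⊔m _ _)

partial : ℕ → ℕ → ℕ
partial zero    u = 0
partial (suc p) u with suc p ≟ u
... | yes _ = 0
... | no  _ = 1

partial-≡ : ∀ u → partial u u ≡ 0
partial-≡ zero = refl
partial-≡ (suc u) with suc u ≟ suc u
... | yes _    = refl
... | no  u≢u = contradiction refl u≢u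

partial-≤1 : ∀ p u → partial p u ≤ 1
partial-≤1 zero    u = z≤n
partial-≤1 (suc p) u with suc p ≟ u
... | yes _ = z≤n
... | no  _ = s≤s z≤n

partial-cases : ∀ p u → p ≡ 0 ⊎ p ≡ u ⊎ partial p u ≡ 1
partial-cases zero    u = inj₁ refl
partial-cases (suc p) u with suc p ≟ u
... | yes p≡u = inj₂ (inj₁ p≡u)
... | no  _   = inj₂ (inj₂ refl)

↭allFin⇒Unique : ∀ {n} {σ : List (Fin n)} → σ ↭ allFin n → Unique σ
↭allFin⇒Unique {n} σ↭ = Unique-resp-↭ (setoid (Fin n)) (↭⇒↭ₛ (↭-sym σ↭)) (allFin⁺ n)

module PrefixSolution {n : ℕ} (s u : Vector ℕ n) (s>0 : ∀ i → 1 ≤ s i) where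

  private
    P = prefixSol s u

    Fits : ℕ → Fin n → Set
    Fits r i = u i * s i ≤ r

  prefixSol-∉ : ∀ r σ j → j ∉ σ → P r σ j ≡ 0
  prefixSol-∉ r []      j j∉σ = refl
  prefixSol-∉ r (i ∷ σ) j j∉σ with u i * s i ≤? r | j ≟ᶠ i
  ... | yes _ | yes j≡i = contradiction (here j≡i) j∉σ
  ... | yes _ | no  _   = prefixSol-∉ (r ∸ u i * s i) σ j (j∉σ ∘ there)
  ... | no  _ | yes j≡i = contradiction (here j≡i) j∉σ
  ... | no  _ | no  _   = refl

  prefixSol-fits-≡ : ∀ r i σ → Fits r i → P r (i ∷ σ) i ≡ u i
  prefixSol-fits-≡ r i σ fits with u i * s i ≤? r | i ≟ᶠ i
  ... | yes _ | yes _   = refl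
  ... | yes _ | no  i≢i = contradiction refl i≢i
  ... | no  ¬fits | _   = contradiction fits ¬fits

  prefixSol-fits-≢ : ∀ r i σ j → Fits r i → j ≢ i → P r (i ∷ σ) j ≡ P (r ∸ u i * s i) σ j
  prefixSol-fits-≢ r i σ j fits j≢i with u i * s i ≤? r | j ≟ᶠ i
  ... | yes _ | yes j≡i = contradiction j≡i j≢i
  ... | yes _ | no  _   = refl
  ... | no  ¬fits | _   = contradiction fits ¬fits

  prefixSol-¬fits-≡ : ∀ r i σ → ¬ Fits r i → P r (i ∷ σ) i ≡ r div s i
  prefixSol-¬fits-≡ r i σ ¬fits with u i * s i ≤? r | i ≟ᶠ i
  ... | yes fits | _     = contradiction fits ¬fits
  ... | no  _ | yes _   = refl
  ... | no  _ | no  i≢i = contradiction refl i≢i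

  prefixSol-¬fits-≢ : ∀ r i σ j → ¬ Fits r i → j ≢ i → P r (i ∷ σ) j ≡ 0
  prefixSol-¬fits-≢ r i σ j ¬fits j≢i with u i * s i ≤? r | j ≟ᶠ i
  ... | yes fits | _     = contradiction fits ¬fits
  ... | no  _ | yes j≡i = contradiction j≡i j≢i
  ... | no  _ | no  _   = refl

  module _ (G : Fin n → ℕ → ℕ) (G0 : ∀ j → G j 0 ≡ 0) where

    sum-prefixSol-fits : ∀ r i σ → i ∉ σ → Fits r i →
      sum (λ j → G j (P r (i ∷ σ) j)) ≡ sum (λ j → G j (P (r ∸ u i * s i) σ j)) + G i (u i)
    sum-prefixSol-fits r i σ i∉σ fits = begin
      Σ[i∷σ]                        ≡⟨ +-identityʳ Σ[i∷σ] ⟨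
      Σ[i∷σ] + 0                    ≡⟨ cong (Σ[i∷σ] +_) G[P′i]≡0 ⟨
      Σ[i∷σ] + G i (P r′ σ i)       ≡⟨ sum-agree-except i (λ j → cong (G j) ∘ prefixSol-fits-≢ r i σ j fits) ⟩
      Σ[σ] + G i (P r (i ∷ σ) i)    ≡⟨ cong (λ v → Σ[σ] + G i v) (prefixSol-fits-≡ r i σ fits) ⟩
      Σ[σ] + G i (u i)              ∎
      where
      open ≡-Reasoning
      r′ = r ∸ u i * s i
      Σ[i∷σ] = sum (λ j → G j (P r (i ∷ σ) j))
      Σ[σ] = sum (λ j → G j (P r′ σ j))
      G[P′i]≡0 : G i (P r′ σ i) ≡ 0
      G[P′i]≡0 = trans (cong (G i) (prefixSol-∉ r′ σ i i∉σ)) (G0 i)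

    sum-prefixSol-¬fits : ∀ r i σ → ¬ Fits r i → sum (λ j → G j (P r (i ∷ σ) j)) ≡ G i (r div s i)
    sum-prefixSol-¬fits r i σ ¬fits = begin
      sum (λ j → G j (P r (i ∷ σ) j))                 ≡⟨ +-identityʳ _ ⟨
      sum (λ j → G j (P r (i ∷ σ) j)) + 0             ≡⟨ sum-agree-except i (λ j j≢i →
                                                           trans (cong (G j) (prefixSol-¬fits-≢ r i σ j ¬fits j≢i)) (G0 j)) ⟩
      sum {n} (λ _ → 0) + G i (P r (i ∷ σ) i)         ≡⟨ cong₂ _+_ (sum-replicate-zero n)
                                                                   (cong (G i) (prefixSol-¬fits-≡ r i σ ¬fits)) ⟩
      G i (r div s i)                                 ∎
      where open ≡-Reasoning

  private
    weight-prefixSol-fits : ∀ r i σ → i ∉ σ → Fits r i →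
      weight s (P r (i ∷ σ)) ≡ weight s (P (r ∸ u i * s i) σ) + u i * s i
    weight-prefixSol-fits r i σ i∉σ fits =
      trans (sum-prefixSol-fits (λ j → s j *_) (λ j → *-zeroʳ (s j)) r i σ i∉σ fits)
            (cong (weight s (P (r ∸ u i * s i) σ) +_) (*-comm (s i) (u i)))

    weight-prefixSol-¬fits : ∀ r i σ → ¬ Fits r i → weight s (P r (i ∷ σ)) ≡ s i * (r div s i)
    weight-prefixSol-¬fits = sum-prefixSol-¬fits (λ j → s j *_) (λ j → *-zeroʳ (s j))

  prefixSol-≤ : ∀ r σ j → P r σ j ≤ u j
  prefixSol-≤ r [] j = z≤n
  prefixSol-≤ r (i ∷ σ) j with u i * s i ≤? r | j ≟ᶠ i
  ... | yes _     | yes refl = ≤-refl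
  ... | yes _     | no  _    = prefixSol-≤ (r ∸ u i * s i) σ j
  ... | no  ¬fits | yes refl = <⇒≤ (div-< (s>0 j) (≰⇒> ¬fits))
  ... | no  _     | no  _    = z≤n

  -- Casing on the fit test through a helper rather than `with` keeps prefixSol folded in the goal,
  -- so that the unfolding lemmas above apply.
  prefixSol-weight-≤ : ∀ r σ → Unique σ → weight s (P r σ) ≤ r
  prefixSol-weight-≤ r [] _ = ≤-trans (≤-reflexive (weight-zero s)) z≤n
  prefixSol-weight-≤ r (i ∷ σ) uniq@(_ ∷ σ!) = by-cases (u i * s i ≤? r)
    where
    by-cases : Dec (Fits r i) → weight s (P r (i ∷ σ)) ≤ r
    by-cases (yes fits) = begin
      weight s (P r (i ∷ σ))                      ≡⟨ weight-prefixSol-fits r i σ (Unique[x∷xs]⇒x∉xs uniq) fits ⟩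
      weight s (P (r ∸ u i * s i) σ) + u i * s i  ≤⟨ +-monoˡ-≤ _ (prefixSol-weight-≤ (r ∸ u i * s i) σ σ!) ⟩
      r ∸ u i * s i + u i * s i                   ≡⟨ m∸n+n≡m fits ⟩
      r                                           ∎
      where open ≤-Reasoning
    by-cases (no ¬fits) = ≤-trans (≤-reflexive (weight-prefixSol-¬fits r i σ ¬fits)) (*-div-≤ r (s>0 i))

  prefixSol-maximal : ∀ {S} → (∀ i → s i ≤ S) → ∀ r σ → Unique σ →
                      (∀ j → j ∈ σ → P r σ j ≡ u j) ⊎ r < weight s (P r σ) + S
  prefixSol-maximal s≤S r [] _ = inj₁ (λ j ())
  prefixSol-maximal {S} s≤S r (i ∷ σ) uniq@(_ ∷ σ!) = by-cases (u i * s i ≤? r)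
    where
    i∉σ = Unique[x∷xs]⇒x∉xs uniq
    r′ = r ∸ u i * s i
    Goal = (∀ j → j ∈ i ∷ σ → P r (i ∷ σ) j ≡ u j) ⊎ r < weight s (P r (i ∷ σ)) + S
    fits-case : Fits r i → (∀ j → j ∈ σ → P r′ σ j ≡ u j) ⊎ r′ < weight s (P r′ σ) + S → Goal
    fits-case fits (inj₁ full) = inj₁ λ where
      j (here refl) → prefixSol-fits-≡ r i σ fits
      j (there j∈σ) → trans (prefixSol-fits-≢ r i σ j fits (λ { refl → i∉σ j∈σ })) (full j j∈σ)
    fits-case fits (inj₂ r′<) = inj₂ (begin-strict
      r                                   ≡⟨ m∸n+n≡m fits ⟨
      r′ + u i * s i                      <⟨ +-monoˡ-< _ r′< ⟩
      weight s (P r′ σ) + S + u i * s i   ≡⟨ xy∙z≈xz∙y (weight s (P r′ σ)) S (u i * s i) ⟩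
      weight s (P r′ σ) + u i * s i + S   ≡⟨ cong (_+ S) (weight-prefixSol-fits r i σ i∉σ fits) ⟨
      weight s (P r (i ∷ σ)) + S          ∎)
      where open ≤-Reasoning
    by-cases : Dec (Fits r i) → Goal
    by-cases (yes fits) = fits-case fits (prefixSol-maximal s≤S r′ σ σ!)
    by-cases (no ¬fits) = inj₂ (begin-strict
      r                              <⟨ <-*-div-+ r (s>0 i) ⟩
      s i * (r div s i) + s i        ≤⟨ +-monoʳ-≤ _ (s≤S i) ⟩
      s i * (r div s i) + S          ≡⟨ cong (_+ S) (weight-prefixSol-¬fits r i σ ¬fits) ⟨
      weight s (P r (i ∷ σ)) + S     ∎)
      where open ≤-Reasoning

  prefixSol-partial : ∀ r σ → Unique σ → sum (λ j → partial (P r σ j) (u j)) ≤ 1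
  prefixSol-partial r [] _ = ≤-trans (≤-reflexive (sum-replicate-zero n)) z≤n
  prefixSol-partial r (i ∷ σ) uniq@(_ ∷ σ!) = by-cases (u i * s i ≤? r)
    where
    G : Fin n → ℕ → ℕ
    G j v = partial v (u j)
    r′ = r ∸ u i * s i
    by-cases : Dec (Fits r i) → sum (λ j → G j (P r (i ∷ σ) j)) ≤ 1
    by-cases (yes fits) = begin
      sum (λ j → G j (P r (i ∷ σ) j))        ≡⟨ sum-prefixSol-fits G (λ _ → refl) r i σ (Unique[x∷xs]⇒x∉xs uniq) fits ⟩
      sum (λ j → G j (P r′ σ j)) + G i (u i) ≡⟨ cong (sum (λ j → G j (P r′ σ j)) +_) (partial-≡ (u i)) ⟩
      sum (λ j → G j (P r′ σ j)) + 0         ≤⟨ +-monoˡ-≤ 0 (prefixSol-partial r′ σ σ!) ⟩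
      1                                      ∎
      where open ≤-Reasoning
    by-cases (no ¬fits) =
      ≤-trans (≤-reflexive (sum-prefixSol-¬fits G (λ _ → refl) r i σ ¬fits)) (partial-≤1 (r div s i) (u i))

  prefixSol-maximal-↭ : ∀ {S} → (∀ i → s i ≤ S) → ∀ r {σ} → σ ↭ allFin n →
                        (∀ j → P r σ j ≡ u j) ⊎ r < weight s (P r σ) + S
  prefixSol-maximal-↭ s≤S r {σ} σ↭ with prefixSol-maximal s≤S r σ (↭allFin⇒Unique σ↭)
  ... | inj₁ full = inj₁ λ j → full j (∈-resp-↭ (↭-sym σ↭) (∈-allFin j))
  ... | inj₂ r<   = inj₂ r<

record Exchange {n} (s e d : Vector ℕ n) : Set where
  field
    α β       : Vector ℕ n
    α≤e       : α ≤ᵥ e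
    β≤d       : β ≤ᵥ d
    balanced  : weight s α ≡ weight s β
    nonempty  : 0 < sum α + sum β

module BalancedWalk {n : ℕ} (s : Vector ℕ n) (s>0 : ∀ i → 1 ≤ s i) {S : ℕ} (1≤S : 1 ≤ S) (s≤S : ∀ i → s i ≤ S)
                (e d : Vector ℕ n) (wd≤we : weight s d ≤ weight s e) (we≤wd+S : weight s e ≤ weight s d + S) where

  record Balanced : Set where
    field
      a b     : Vector ℕ n
      a≤e     : a ≤ᵥ e
      b≤d     : b ≤ᵥ d
      wb<wa+S : weight s b < weight s a + S
      wa≤wb+S : weight s a ≤ weight s b + S
  open Balanced

  size : Balanced → ℕ
  size st = sum (a st) + sum (b st)

  _⊑_ : Balanced → Balanced → Set
  st ⊑ st′ = a st ≤ᵥ a st′ × b st ≤ᵥ b st′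

  ⊑-refl : ∀ st → st ⊑ st
  ⊑-refl _ = (λ _ → ≤-refl) , (λ _ → ≤-refl)

  ⊑-trans : ∀ {st st′ st″} → st ⊑ st′ → st′ ⊑ st″ → st ⊑ st″
  ⊑-trans (a≤a′ , b≤b′) (a′≤a″ , b′≤b″) = ≤ᵥ-trans a≤a′ a′≤a″ , ≤ᵥ-trans b≤b′ b′≤b″

  empty : Balanced
  empty = record
    { a = λ _ → 0 ; b = λ _ → 0 ; a≤e = λ _ → z≤n ; b≤d = λ _ → z≤n
    ; wb<wa+S = subst₂ _<_ (sym (weight-zero s)) (cong (_+ S) (sym (weight-zero s))) 1≤S
    ; wa≤wb+S = subst (_≤ weight s (λ _ → 0) + S) (sym (weight-zero s)) z≤n
    }

  Extension : Balanced → Set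
  Extension st = Σ Balanced λ st′ → st ⊑ st′ × size st′ ≡ suc (size st)

  extend : (st : Balanced) → size st < sum e + sum d → Extension st
  extend st size<D = by-cases (A ≤? B) (≤ᵥ⇒<⊎≗ (a≤e st)) (≤ᵥ⇒<⊎≗ (b≤d st))
    where
    A = weight s (a st)
    B = weight s (b st)

    grow-a : ∀ i → a st i < e i → B < A + s i + S → A + s i ≤ B + S → Extension st
    grow-a i ai<ei inv₁ inv₂ = record
      { a = updateAt (a st) i suc ; b = b st ; a≤e = updateAt-suc-≤ᵥ i (a≤e st) ai<ei ; b≤d = b≤d st
      ; wb<wa+S = subst (λ w → B < w + S) (sym (weight-updateAt-suc s (a st) i)) inv₁
      ; wa≤wb+S = subst (_≤ B + S) (sym (weight-updateAt-suc s (a st) i)) inv₂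
      } , (≤ᵥ-updateAt-suc (a st) i , λ _ → ≤-refl) , cong (_+ sum (b st)) (sum-updateAt-suc (a st) i)

    grow-b : ∀ j → b st j < d j → B + s j < A + S → A ≤ B + s j + S → Extension st
    grow-b j bj<dj inv₁ inv₂ = record
      { a = a st ; b = updateAt (b st) j suc ; a≤e = a≤e st ; b≤d = updateAt-suc-≤ᵥ j (b≤d st) bj<dj
      ; wb<wa+S = subst (_< A + S) (sym (weight-updateAt-suc s (b st) j)) inv₁
      ; wa≤wb+S = subst (λ w → A ≤ w + S) (sym (weight-updateAt-suc s (b st) j)) inv₂
      } , ((λ _ → ≤-refl) , ≤ᵥ-updateAt-suc (b st) j)
        , trans (cong (sum (a st) +_) (sum-updateAt-suc (b st) j)) (+-suc (sum (a st)) (sum (b st)))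

    by-cases : Dec (A ≤ B) → (∃ λ i → a st i < e i) ⊎ (∀ i → a st i ≡ e i)
                           → (∃ λ j → b st j < d j) ⊎ (∀ j → b st j ≡ d j) → Extension st
    by-cases (yes A≤B) (inj₁ (i , ai<ei)) _ = grow-a i ai<ei
      (<-≤-trans (wb<wa+S st) (+-monoˡ-≤ S (m≤m+n A (s i))))
      (+-mono-≤ A≤B (s≤S i))
    by-cases (yes A≤B) (inj₂ a≗e) (inj₁ (j , bj<dj)) = contradiction A≤B (<⇒≱ (begin-strict
      B                  <⟨ weight-mono-< s>0 (b≤d st) j bj<dj ⟩
      weight s d         ≤⟨ wd≤we ⟩
      weight s e         ≡⟨ sum-cong-≗ (λ i → cong (s i *_) (a≗e i)) ⟨
      A                  ∎))
      where open ≤-Reasoning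
    by-cases (no A≰B) _ (inj₁ (j , bj<dj)) = grow-b j bj<dj
      (+-mono-<-≤ (≰⇒> A≰B) (s≤S j))
      (≤-trans (wa≤wb+S st) (+-monoˡ-≤ S (m≤m+n B (s j))))
    by-cases (no A≰B) (inj₁ (i , ai<ei)) (inj₂ b≗d) = grow-a i ai<ei
      (≤-trans (≰⇒> A≰B) (≤-trans (m≤m+n A (s i)) (m≤m+n (A + s i) S)))
      (begin
        A + s i          ≡⟨ weight-updateAt-suc s (a st) i ⟨
        weight s (updateAt (a st) i suc) ≤⟨ weight-mono-≤ s (updateAt-suc-≤ᵥ i (a≤e st) ai<ei) ⟩
        weight s e       ≤⟨ we≤wd+S ⟩
        weight s d + S   ≡⟨ cong (_+ S) (sum-cong-≗ (λ j → cong (s j *_) (b≗d j))) ⟨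
        B + S            ∎)
      where open ≤-Reasoning
    by-cases _ (inj₂ a≗e) (inj₂ b≗d) = contradiction size<D (<-irrefl (cong₂ _+_ (sum-cong-≗ a≗e) (sum-cong-≗ b≗d)))

  grow : Balanced → Balanced
  grow st with size st <? sum e + sum d
  ... | yes size<D = proj₁ (extend st size<D)
  ... | no  _      = st

  ⊑-grow : ∀ st → st ⊑ grow st
  ⊑-grow st with size st <? sum e + sum d
  ... | yes size<D = proj₁ (proj₂ (extend st size<D))
  ... | no  _      = ⊑-refl st

  size-grow : ∀ st → size st < sum e + sum d → size (grow st) ≡ suc (size st)
  size-grow st size<D with size st <? sum e + sum d
  ... | yes size<D = proj₂ (proj₂ (extend st size<D))
  ... | no  size≮D = contradiction size<D size≮D

  walk : ℕ → Balanced
  walk zero    = empty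
  walk (suc m) = grow (walk m)

  size-walk : ∀ m → m ≤ sum e + sum d → size (walk m) ≡ m
  size-walk zero    _ = cong₂ _+_ (sum-replicate-zero n) (sum-replicate-zero n)
  size-walk (suc m) m<D = trans (size-grow (walk m) (subst (_< _) (sym ih) m<D)) (cong suc ih)
    where ih = size-walk m (<⇒≤ m<D)

  walk-mono : ∀ {m m′} → m ≤ m′ → walk m ⊑ walk m′
  walk-mono {m′ = zero}   z≤n = ⊑-refl empty
  walk-mono {m} {suc m′} m≤1+m′ with m≤n⇒m<n∨m≡n m≤1+m′
  ... | inj₁ m<1+m′ =
    ⊑-trans {walk m} {walk m′} {walk (suc m′)} (walk-mono {m} {m′} (s≤s⁻¹ m<1+m′)) (⊑-grow (walk m′))
  ... | inj₂ refl   = ⊑-refl (walk (suc m′))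

  window : Balanced → ℕ
  window st = weight s (a st) + S ∸ suc (weight s (b st))

  window<2S : ∀ st → window st < S + S
  window<2S st = m<n+o⇒m∸n<o (A + S) (suc B) {{>-nonZero (≤-trans 1≤S (m≤m+n S S))}}
    (s≤s (≤-trans (+-monoˡ-≤ S (wa≤wb+S st)) (≤-reflexive (+-assoc B S S))))
    where
    A = weight s (a st)
    B = weight s (b st)

  window-≡ : ∀ st st′ → window st ≡ window st′ →
             weight s (a st) + weight s (b st′) ≡ weight s (a st′) + weight s (b st)
  window-≡ st st′ eq = +-cancelʳ-≡ S _ _ (suc-injective (begin
    suc (A + B′ + S)          ≡⟨ cong suc (xy∙z≈xz∙y A B′ S) ⟩
    suc (A + S + B′)          ≡⟨ +-suc (A + S) B′ ⟨
    A + S + suc B′            ≡⟨ cong (_+ suc B′) (m∸n+n≡m (wb<wa+S st)) ⟨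
    window st + suc B + suc B′ ≡⟨ cong (λ w → w + suc B + suc B′) eq ⟩
    window st′ + suc B + suc B′ ≡⟨ xy∙z≈xz∙y (window st′) (suc B) (suc B′) ⟩
    window st′ + suc B′ + suc B ≡⟨ cong (_+ suc B) (m∸n+n≡m (wb<wa+S st′)) ⟩
    A′ + S + suc B            ≡⟨ +-suc (A′ + S) B ⟩
    suc (A′ + S + B)          ≡⟨ cong suc (xy∙z≈xz∙y A′ B S) ⟨
    suc (A′ + B + S)          ∎))
    where
    open ≡-Reasoning
    A = weight s (a st)
    B = weight s (b st)
    A′ = weight s (a st′)
    B′ = weight s (b st′)

  exchange : S + S ≤ sum e + sum d → Exchange s e d
  exchange 2S≤D = record { α = α ; β = β ; α≤e = α≤e ; β≤d = β≤d ; balanced = wα≡wβ ; nonempty = 0<|α|+|β| }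
    where
    index : Fin (suc (S + S)) → Fin (S + S)
    index m = fromℕ< (window<2S (walk (toℕ m)))
    collision = pigeonhole (n<1+n (S + S)) index
    m₁ = toℕ (proj₁ collision)
    m₂ = toℕ (proj₁ (proj₂ collision))
    m₁<m₂ : m₁ < m₂
    m₁<m₂ = proj₁ (proj₂ (proj₂ collision))
    m₂≤D : m₂ ≤ sum e + sum d
    m₂≤D = ≤-trans (toℕ≤pred[n] (proj₁ (proj₂ collision))) 2S≤D
    st₁ = walk m₁
    st₂ = walk m₂
    a₁≤a₂ : a st₁ ≤ᵥ a st₂
    a₁≤a₂ = proj₁ (walk-mono (<⇒≤ m₁<m₂))
    b₁≤b₂ : b st₁ ≤ᵥ b st₂
    b₁≤b₂ = proj₂ (walk-mono (<⇒≤ m₁<m₂))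
    α β : Vector ℕ n
    α i = a st₂ i ∸ a st₁ i
    β i = b st₂ i ∸ b st₁ i
    α≤e : α ≤ᵥ e
    α≤e i = ≤-trans (m∸n≤m (a st₂ i) (a st₁ i)) (a≤e st₂ i)
    β≤d : β ≤ᵥ d
    β≤d i = ≤-trans (m∸n≤m (b st₂ i) (b st₁ i)) (b≤d st₂ i)
    same-window : window st₁ ≡ window st₂
    same-window = trans (sym (toℕ-fromℕ< (window<2S st₁)))
                        (trans (cong toℕ (proj₂ (proj₂ (proj₂ collision)))) (toℕ-fromℕ< (window<2S st₂)))
    wα≡wβ : weight s α ≡ weight s β
    wα≡wβ = +-cancelʳ-≡ (A₁ + B₁) _ _ (begin
      weight s α + (A₁ + B₁)   ≡⟨ +-assoc (weight s α) A₁ B₁ ⟨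
      weight s α + A₁ + B₁     ≡⟨ cong (_+ B₁) (weight-∸ s a₁≤a₂) ⟩
      weight s (a st₂) + B₁    ≡⟨ window-≡ st₁ st₂ same-window ⟨
      A₁ + weight s (b st₂)    ≡⟨ cong (A₁ +_) (weight-∸ s b₁≤b₂) ⟨
      A₁ + (weight s β + B₁)   ≡⟨ x∙yz≈y∙xz A₁ (weight s β) B₁ ⟩
      weight s β + (A₁ + B₁)   ∎)
      where
      open ≡-Reasoning
      A₁ = weight s (a st₁)
      B₁ = weight s (b st₁)
    0<|α|+|β| : 0 < sum α + sum β
    0<|α|+|β| = +-cancelʳ-< m₁ 0 (sum α + sum β) (begin-strict
      m₁                                            <⟨ m₁<m₂ ⟩
      m₂                                            ≡⟨ size-walk m₂ m₂≤D ⟨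
      sum (a st₂) + sum (b st₂)                     ≡⟨ cong₂ _+_ (sum-∸ a₁≤a₂) (sum-∸ b₁≤b₂) ⟨
      (sum α + sum (a st₁)) + (sum β + sum (b st₁)) ≡⟨ interchange (sum α) (sum (a st₁)) (sum β) (sum (b st₁)) ⟩
      (sum α + sum β) + (sum (a st₁) + sum (b st₁)) ≡⟨ cong (sum α + sum β +_) (size-walk m₁ (≤-trans (<⇒≤ m₁<m₂) m₂≤D)) ⟩
      sum α + sum β + m₁                           ∎)
      where open ≤-Reasoning

module Proximity {n : ℕ} (s : Vector ℕ n) (s>0 : ∀ i → 1 ≤ s i) {S : ℕ} (1≤S : 1 ≤ S) (s≤S : ∀ i → s i ≤ S)
                 {p u : Vector ℕ n} {t : ℕ} (p≤u : p ≤ᵥ u) (wp≤t : weight s p ≤ t)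
                 (maximal : (∀ i → p i ≡ u i) ⊎ t < weight s p + S) where

  record Deviation : Set where
    field
      excess deficit : Vector ℕ n
      deficit≤p      : deficit ≤ᵥ p
      p+excess≤u     : ∀ i → p i + excess i ≤ u i
      balance        : weight s p + weight s excess ≡ t + weight s deficit
  open Deviation

  ‖_‖ : Deviation → ℕ
  ‖ δ ‖ = sum (excess δ) + sum (deficit δ)

  deficit-weight-≤ : ∀ δ → weight s (deficit δ) ≤ weight s (excess δ)
  deficit-weight-≤ δ = +-cancelˡ-≤ t _ _ (begin
    t + weight s (deficit δ)             ≡⟨ balance δ ⟨
    weight s p + weight s (excess δ)     ≤⟨ +-monoˡ-≤ (weight s (excess δ)) wp≤t ⟩
    t + weight s (excess δ)              ∎)
    where open ≤-Reasoning

  excess-weight-≤ : ∀ δ → weight s (excess δ) ≤ weight s (deficit δ) + S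
  excess-weight-≤ δ = by-maximality maximal
    where
    e = excess δ
    d = deficit δ
    by-maximality : (∀ i → p i ≡ u i) ⊎ t < weight s p + S → weight s e ≤ weight s d + S
    by-maximality (inj₁ p≗u) =
      ≤-trans (≤-reflexive (trans (sum-cong-≗ (λ i → cong (s i *_) (e≡0 i))) (weight-zero s))) z≤n
      where
      e≡0 : ∀ i → e i ≡ 0
      e≡0 i = n≤0⇒n≡0 (+-cancelˡ-≤ (p i) _ 0
                (subst (p i + e i ≤_) (trans (sym (p≗u i)) (sym (+-identityʳ (p i)))) (p+excess≤u δ i)))
    by-maximality (inj₂ t<wp+S) = <⇒≤ (+-cancelˡ-< (weight s p) _ _ (begin-strict
      weight s p + weight s e       ≡⟨ balance δ ⟩
      t + weight s d                <⟨ +-monoˡ-< (weight s d) t<wp+S ⟩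
      weight s p + S + weight s d   ≡⟨ x∙yz≈xz∙y (weight s p) (weight s d) S ⟨
      weight s p + (weight s d + S) ∎))
      where open ≤-Reasoning

  remove : ∀ δ → Exchange s (excess δ) (deficit δ) → Deviation
  remove δ ex = record
    { excess     = e′
    ; deficit    = d′
    ; deficit≤p  = λ i → ≤-trans (m∸n≤m (d i) (β i)) (deficit≤p δ i)
    ; p+excess≤u = λ i → ≤-trans (+-monoʳ-≤ (p i) (m∸n≤m (e i) (α i))) (p+excess≤u δ i)
    ; balance    = +-cancelʳ-≡ (weight s α) _ _ (begin
        weight s p + weight s e′ + weight s α   ≡⟨ +-assoc (weight s p) (weight s e′) (weight s α) ⟩
        weight s p + (weight s e′ + weight s α) ≡⟨ cong (weight s p +_) (weight-∸ s α≤e) ⟩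
        weight s p + weight s e                 ≡⟨ balance δ ⟩
        t + weight s d                          ≡⟨ cong (t +_) (weight-∸ s β≤d) ⟨
        t + (weight s d′ + weight s β)          ≡⟨ +-assoc t (weight s d′) (weight s β) ⟨
        t + weight s d′ + weight s β            ≡⟨ cong (t + weight s d′ +_) balanced ⟨
        t + weight s d′ + weight s α            ∎)
    }
    where
    open ≡-Reasoning
    open Exchange ex
    e = excess δ
    d = deficit δ
    e′ d′ : Vector ℕ n
    e′ i = e i ∸ α i
    d′ i = d i ∸ β i

  ‖remove‖ : ∀ δ ex → ‖ remove δ ex ‖ + (sum (Exchange.α ex) + sum (Exchange.β ex)) ≡ ‖ δ ‖
  ‖remove‖ δ ex = trans
    (interchange (sum (λ i → excess δ i ∸ α i)) (sum (λ i → deficit δ i ∸ β i)) (sum α) (sum β))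
    (cong₂ _+_ (sum-∸ α≤e) (sum-∸ β≤d))
    where open Exchange ex

  shrink : (δ : Deviation) → S + S ≤ ‖ δ ‖ → Σ Deviation λ δ′ → ‖ δ′ ‖ < ‖ δ ‖
  shrink δ 2S≤‖δ‖ =
    remove δ ex , subst (‖ remove δ ex ‖ <_) (‖remove‖ δ ex) (m<m+n ‖ remove δ ex ‖ (Exchange.nonempty ex))
    where
    ex = BalancedWalk.exchange s s>0 1≤S s≤S (excess δ) (deficit δ) (deficit-weight-≤ δ) (excess-weight-≤ δ) 2S≤‖δ‖

  small-deviation : ∀ m δ → ‖ δ ‖ ≤ m → Σ Deviation λ δ′ → ‖ δ′ ‖ ≤ S + S
  small-deviation m δ ‖δ‖≤m with ‖ δ ‖ ≤? S + S
  ... | yes ‖δ‖≤2S = δ , ‖δ‖≤2S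
  small-deviation zero    δ ‖δ‖≤0   | no ‖δ‖≰2S = contradiction (≤-trans ‖δ‖≤0 z≤n) ‖δ‖≰2S
  small-deviation (suc m) δ ‖δ‖≤1+m | no ‖δ‖≰2S =
    let δ′ , ‖δ′‖<‖δ‖ = shrink δ (<⇒≤ (≰⇒> ‖δ‖≰2S)) in
    small-deviation m δ′ (s≤s⁻¹ (≤-trans ‖δ′‖<‖δ‖ ‖δ‖≤1+m))

  deviation-of : ∀ {x} → x ≤ᵥ u → weight s x ≡ t → Deviation
  deviation-of {x} x≤u wx≡t = record
    { excess     = λ i → x i ∸ p i
    ; deficit    = λ i → p i ∸ x i
    ; deficit≤p  = λ i → m∸n≤m (p i) (x i)
    ; p+excess≤u = λ i → m+[n∸m]≤o (p≤u i) (x≤u i)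
    ; balance    = begin
        weight s p + weight s (λ i → x i ∸ p i) ≡⟨ weight-+ s p (λ i → x i ∸ p i) ⟨
        weight s (λ i → p i + (x i ∸ p i))      ≡⟨ sum-cong-≗ (λ i → cong (s i *_) (m+[n∸m]≡n+[m∸n] (p i) (x i))) ⟩
        weight s (λ i → x i + (p i ∸ x i))      ≡⟨ weight-+ s x (λ i → p i ∸ x i) ⟩
        weight s x + weight s (λ i → p i ∸ x i) ≡⟨ cong (_+ weight s (λ i → p i ∸ x i)) wx≡t ⟩
        t + weight s (λ i → p i ∸ x i)          ∎
    }
    where open ≡-Reasoning

  solution-of : Deviation → Vector ℕ n
  solution-of δ i = p i + excess δ i ∸ deficit δ i

  solution-of-≤ : ∀ δ → solution-of δ ≤ᵥ u
  solution-of-≤ δ i = ≤-trans (m∸n≤m (p i + excess δ i) (deficit δ i)) (p+excess≤u δ i)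

  weight-solution-of : ∀ δ → weight s (solution-of δ) ≡ t
  weight-solution-of δ = +-cancelʳ-≡ (weight s d) _ _ (begin
    weight s (solution-of δ) + weight s d ≡⟨ weight-∸ s d≤p+e ⟩
    weight s (λ i → p i + e i)            ≡⟨ weight-+ s p e ⟩
    weight s p + weight s e               ≡⟨ balance δ ⟩
    t + weight s d                        ∎)
    where
    open ≡-Reasoning
    e = excess δ
    d = deficit δ
    d≤p+e : d ≤ᵥ (λ i → p i + e i)
    d≤p+e i = ≤-trans (deficit≤p δ i) (m≤m+n (p i) (e i))

  ∣solution-of-p∣≤ : ∀ δ i → ∣ solution-of δ i - p i ∣ ≤ excess δ i + deficit δ i
  ∣solution-of-p∣≤ δ i = ∣-∣≤
    (≤-trans (m∸n≤m (p i + e) d) (+-monoʳ-≤ (p i) (m≤m+n e d)))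
    (begin
      p i                       ≤⟨ m≤m+n (p i) e ⟩
      p i + e                   ≡⟨ m∸n+n≡m (≤-trans (deficit≤p δ i) (m≤m+n (p i) e)) ⟨
      solution-of δ i + d       ≤⟨ +-monoʳ-≤ (solution-of δ i) (m≤n+m d e) ⟩
      solution-of δ i + (e + d) ∎)
    where
    open ≤-Reasoning
    e = excess δ i
    d = deficit δ i

  proximity : ∀ {x} → x ≤ᵥ u → weight s x ≡ t →
              Σ (Vector ℕ n) λ x′ → x′ ≤ᵥ u × weight s x′ ≡ t × sum (λ i → ∣ x′ i - p i ∣) ≤ S + S
  proximity x≤u wx≡t = solution-of δ , solution-of-≤ δ , weight-solution-of δ , (begin
    sum (λ i → ∣ solution-of δ i - p i ∣)     ≤⟨ sum-mono-≤ (∣solution-of-p∣≤ δ) ⟩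
    sum (λ i → excess δ i + deficit δ i)      ≡⟨ ∑-distrib-+ (excess δ) (deficit δ) ⟩
    ‖ δ ‖                                     ≤⟨ proj₂ small ⟩
    S + S                                     ∎)
    where
    open ≤-Reasoning
    δ₀ = deviation-of x≤u wx≡t
    small = small-deviation ‖ δ₀ ‖ δ₀ ≤-refl
    δ = proj₁ small

module Rounding (k : ℕ) where

  -- With K = suc k, `u div K` computes to `u / K`, so the division lemmas of the library apply.
  K : ℕ
  K = suc k

  /-≤ : ∀ {m} c → m ≤ c * K → m / K ≤ c
  /-≤ c m≤cK = subst (_ ≤_) (m*n/n≡m c K) (/-monoˡ-≤ K m≤cK)

  ≤-/ : ∀ {m} c → c * K ≤ m → c ≤ m / K
  ≤-/ c cK≤m = subst (_≤ _) (m*n/n≡m c K) (/-monoˡ-≤ K cK≤m)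

  uUp*K≤ : ∀ u → uUp K u * K ≤ u ∸ 8 * K
  uUp*K≤ u = begin
    (u / K ∸ 8) * K   ≡⟨ *-distribʳ-∸ K (u / K) 8 ⟩
    u / K * K ∸ 8 * K ≤⟨ ∸-monoˡ-≤ (8 * K) (m/n*n≤m u K) ⟩
    u ∸ 8 * K         ∎
    where open ≤-Reasoning

  uUp-≤-/ : ∀ {u y} c → c ≤ 8 → u ∸ c * K ≤ y → uUp K u ≤ y / K
  uUp-≤-/ {u} {y} c c≤8 u∸cK≤y = ≤-/ (uUp K u) (begin
    uUp K u * K ≤⟨ uUp*K≤ u ⟩
    u ∸ 8 * K   ≤⟨ ∸-monoʳ-≤ u (*-monoˡ-≤ K c≤8) ⟩
    u ∸ c * K   ≤⟨ u∸cK≤y ⟩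
    y           ∎)
    where open ≤-Reasoning

  ≤-uDown : ∀ {x u} → x ≤ u → x ≤ 8 * K → x ≤ uDown K u
  ≤-uDown {x} {u} x≤u x≤8K = begin
    x                        ≤⟨ x≤u∸[u∸8K] (≤-total u (8 * K)) ⟩
    u ∸ (u ∸ 8 * K)          ≤⟨ ∸-monoʳ-≤ u (subst (_≤ u ∸ 8 * K) (*-comm (uUp K u) K) (uUp*K≤ u)) ⟩
    u ∸ K * uUp K u          ∎
    where
    open ≤-Reasoning
    x≤u∸[u∸8K] : u ≤ 8 * K ⊎ 8 * K ≤ u → x ≤ u ∸ (u ∸ 8 * K)
    x≤u∸[u∸8K] (inj₁ u≤8K) = subst (λ d → x ≤ u ∸ d) (sym (m≤n⇒m∸n≡0 u≤8K)) x≤u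
    x≤u∸[u∸8K] (inj₂ 8K≤u) = subst (x ≤_) (sym (m∸[m∸n]≡n 8K≤u)) x≤8K

  rounded : ℕ → ℕ → ℕ
  rounded u x = uUp K u ⊓ (x / K)

  robustUp-zero : ∀ u → robustUp K u 0 ≡ 0
  robustUp-zero u with 0 ≤? 4 * K
  ... | yes _  = refl
  ... | no 0≰ = contradiction z≤n 0≰

  robustUp-full : ∀ u → robustUp K u u ≡ uUp K u
  robustUp-full u with u ≤? 4 * K | u ≤? 8 * K
  ... | yes u≤4K | _ = sym (m≤n⇒m∸n≡0 (≤-trans (/-≤ 4 u≤4K) (+-monoʳ-≤ 4 z≤n)))
  ... | no _ | yes u≤8K = sym (m≤n⇒m∸n≡0 (/-≤ 8 u≤8K))
  ... | no _ | no _ with u ∸ 4 * K ≤? u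
  ...   | yes _ = refl
  ...   | no u∸4K≰u = contradiction (m∸n≤m u (4 * K)) u∸4K≰u

  ∣uUp⊓/-robustUp∣≤4 : ∀ u p → ∣ uUp K u ⊓ (p / K) - robustUp K u p ∣ ≤ 4
  ∣uUp⊓/-robustUp∣≤4 u p with p ≤? 4 * K | u ≤? 8 * K
  ... | yes p≤4K | _ = ≤-trans (≤-reflexive (∣-∣-identityʳ _)) (≤-trans (m⊓n≤n (uUp K u) _) (/-≤ 4 p≤4K))
  ... | no _ | yes u≤8K = ≤-trans (≤-reflexive (∣-∣-identityʳ _))
                            (≤-trans (m⊓n≤m (uUp K u) _) (≤-trans (≤-reflexive (m≤n⇒m∸n≡0 (/-≤ 8 u≤8K))) z≤n))
  ... | no _ | no u≰8K with u ∸ 4 * K ≤? p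
  ...   | yes u∸4K≤p = ≤-trans (≤-reflexive (trans
                          (cong (λ v → ∣ v - uUp K u ∣) (m≤n⇒m⊓n≡m (uUp-≤-/ {u} 4 (+-monoʳ-≤ 4 z≤n) u∸4K≤p)))
                          (∣n-n∣≡0 (uUp K u)))) z≤n
  ...   | no u∸4K≰p = ∣-∣≤ (begin
          uUp K u ⊓ P        ≤⟨ m⊓n≤n (uUp K u) P ⟩
          P                  ≤⟨ m≤n+m∸n P 2 ⟩
          2 + (P ∸ 2)        ≤⟨ +-monoˡ-≤ (P ∸ 2) (+-monoʳ-≤ 2 z≤n) ⟩
          4 + (P ∸ 2)        ≡⟨ +-comm 4 (P ∸ 2) ⟩
          P ∸ 2 + 4          ∎)
        (begin
          P ∸ 2              ≤⟨ ⊓-glb (≤-trans (m∸n≤m P 2) P≤uUp+4) (≤-trans (m∸n≤m P 2) (m≤m+n P 4)) ⟩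
          (uUp K u + 4) ⊓ (P + 4) ≡⟨ +-distribʳ-⊓ 4 (uUp K u) P ⟨
          uUp K u ⊓ P + 4    ∎)
    where
    open ≤-Reasoning
    P = p / K
    P+4≤u/K : P + 4 ≤ u / K
    P+4≤u/K = ≤-/ (P + 4) (begin
      (P + 4) * K         ≡⟨ *-distribʳ-+ K P 4 ⟩
      P * K + 4 * K       ≤⟨ +-monoˡ-≤ (4 * K) (m/n*n≤m p K) ⟩
      p + 4 * K           ≤⟨ m≤o∸n⇒m+n≤o p 4K≤u (<⇒≤ (≰⇒> u∸4K≰p)) ⟩
      u                   ∎)
      where
      4K≤u = ≤-trans (*-monoˡ-≤ K (+-monoʳ-≤ 4 (z≤n {4}))) (<⇒≤ (≰⇒> u≰8K))
    P≤uUp+4 : P ≤ uUp K u + 4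
    P≤uUp+4 = +-cancelʳ-≤ 4 P (uUp K u + 4) (begin
      P + 4               ≤⟨ P+4≤u/K ⟩
      u / K               ≡⟨ m∸n+n≡m (≤-/ 8 (<⇒≤ (≰⇒> u≰8K))) ⟨
      u / K ∸ 8 + 8       ≡⟨ +-assoc (uUp K u) 4 4 ⟨
      uUp K u + 4 + 4     ∎)

  1≤K : 1 ≤ K
  1≤K = s≤s z≤n

  ∣/-/∣*K≤ : ∀ x p → ∣ x / K - p / K ∣ * K ≤ ∣ x - p ∣ + K
  ∣/-/∣*K≤ x p = begin
    ∣ x / K - p / K ∣ * K           ≡⟨ *-comm _ K ⟩
    K * ∣ x / K - p / K ∣           ≡⟨ *-distribˡ-∣-∣ K (x / K) (p / K) ⟩
    ∣ K * (x / K) - K * (p / K) ∣   ≤⟨ ∣-∣≤ (below x p)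
                                            (subst (λ d → K * (p / K) ≤ K * (x / K) + (d + K)) (∣-∣-comm p x) (below p x)) ⟩
    ∣ x - p ∣ + K                   ∎
    where
    open ≤-Reasoning
    below : ∀ x p → K * (x / K) ≤ K * (p / K) + (∣ x - p ∣ + K)
    below x p = begin
      K * (x / K)                   ≤⟨ *-div-≤ x 1≤K ⟩
      x                             ≤⟨ m≤n+∣m-n∣ x p ⟩
      p + ∣ x - p ∣                 ≤⟨ +-monoˡ-≤ _ (<⇒≤ (<-*-div-+ p 1≤K)) ⟩
      K * (p / K) + K + ∣ x - p ∣   ≡⟨ +-assoc (K * (p / K)) K _ ⟩
      K * (p / K) + (K + ∣ x - p ∣) ≡⟨ cong (K * (p / K) +_) (+-comm K _) ⟩
      K * (p / K) + (∣ x - p ∣ + K) ∎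

  rounded-error : ∀ u x p → ∣ rounded u x - robustUp K u p ∣ * K ≤ ∣ x - p ∣ + 5 * K
  rounded-error u x p = begin
    ∣ gx - p↑ ∣ * K                         ≤⟨ *-monoˡ-≤ K (∣-∣-triangle gx gp p↑) ⟩
    (∣ gx - gp ∣ + ∣ gp - p↑ ∣) * K         ≤⟨ *-monoˡ-≤ K (+-mono-≤ (∣⊓-⊓∣≤∣-∣ (uUp K u) (x / K) (p / K))
                                                                    (∣uUp⊓/-robustUp∣≤4 u p)) ⟩
    (∣ x / K - p / K ∣ + 4) * K             ≡⟨ *-distribʳ-+ K ∣ x / K - p / K ∣ 4 ⟩
    ∣ x / K - p / K ∣ * K + 4 * K           ≤⟨ +-monoˡ-≤ (4 * K) (∣/-/∣*K≤ x p) ⟩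
    ∣ x - p ∣ + K + 4 * K                   ≡⟨ +-assoc ∣ x - p ∣ K (4 * K) ⟩
    ∣ x - p ∣ + 5 * K                       ∎
    where
    open ≤-Reasoning
    gx = rounded u x
    gp = uUp K u ⊓ (p / K)
    p↑ = robustUp K u p

  rounded-exact-zero : ∀ u {x} → x < K → rounded u x ≡ robustUp K u 0
  rounded-exact-zero u x<K =
    trans (cong (uUp K u ⊓_) (m<n⇒m/n≡0 x<K)) (trans (⊓-zeroʳ (uUp K u)) (sym (robustUp-zero u)))

  rounded-exact-full : ∀ u {x} → u < x + K → rounded u x ≡ robustUp K u u
  rounded-exact-full u {x} u<x+K = trans (m≤n⇒m⊓n≡m (uUp-≤-/ {u} 1 (s≤s z≤n) u∸1*K≤x))
                                         (sym (robustUp-full u))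
    where
    u∸1*K≤x : u ∸ 1 * K ≤ x
    u∸1*K≤x = subst (λ c → u ∸ c ≤ x) (sym (*-identityˡ K))
                (m≤n+o⇒m∸n≤o u K (subst (u ≤_) (+-comm x K) (<⇒≤ u<x+K)))

  rounded-error-exact-or-far : ∀ u x p → (∣ x - p ∣ < K → rounded u x ≡ robustUp K u p) →
                               ∣ rounded u x - robustUp K u p ∣ * K ≤ 6 * ∣ x - p ∣
  rounded-error-exact-or-far u x p exact with ∣ x - p ∣ <? K
  ... | yes close = subst (λ d → d * K ≤ 6 * ∣ x - p ∣) (sym (m≡n⇒∣m-n∣≡0 (exact close))) z≤n
  ... | no ¬close = begin
    ∣ rounded u x - robustUp K u p ∣ * K ≤⟨ rounded-error u x p ⟩
    ∣ x - p ∣ + 5 * K                    ≤⟨ +-monoʳ-≤ ∣ x - p ∣ (*-monoʳ-≤ 5 (≮⇒≥ ¬close)) ⟩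
    6 * ∣ x - p ∣                        ∎
    where open ≤-Reasoning

  rounded-error-partial : ∀ u x p → x ≤ u →
    ∣ rounded u x - robustUp K u p ∣ * K ≤ 6 * ∣ x - p ∣ + 5 * K * partial p u
  rounded-error-partial u x p x≤u with partial-cases p u
  ... | inj₂ (inj₂ partial≡1) = begin
    ∣ rounded u x - robustUp K u p ∣ * K ≤⟨ rounded-error u x p ⟩
    ∣ x - p ∣ + 5 * K                    ≤⟨ +-mono-≤ (m≤n*m ∣ x - p ∣ 6) (≤-reflexive (sym (*-identityʳ (5 * K)))) ⟩
    6 * ∣ x - p ∣ + 5 * K * 1            ≡⟨ cong (λ b → 6 * ∣ x - p ∣ + 5 * K * b) partial≡1 ⟨
    6 * ∣ x - p ∣ + 5 * K * partial p u  ∎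
    where open ≤-Reasoning
  ... | inj₁ refl = ≤-trans (rounded-error-exact-or-far u x 0 λ close →
                               rounded-exact-zero u (subst (_< K) (∣-∣-identityʳ x) close))
                            (m≤m+n _ _)
  ... | inj₂ (inj₁ refl) = ≤-trans (rounded-error-exact-or-far u x u λ close →
                                      rounded-exact-full u (begin-strict
                                        u               ≤⟨ m≤n+m∸n u x ⟩
                                        x + (u ∸ x)     <⟨ +-monoʳ-< x (subst (_< K) (m≤n⇒∣m-n∣≡n∸m x≤u) close) ⟩
                                        x + K           ∎))
                                   (m≤m+n _ _)
    where open ≤-Reasoning

  rounded-≤-uUp : ∀ u x → rounded u x ≤ uUp K u
  rounded-≤-uUp u x = m⊓n≤m (uUp K u) (x / K)

  *-rounded-≤ : ∀ u x → K * rounded u x ≤ x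
  *-rounded-≤ u x = ≤-trans (*-monoʳ-≤ K (m⊓n≤n (uUp K u) (x / K))) (*-div-≤ x 1≤K)

  ∸-*-rounded-≤-uDown : ∀ u x → x ≤ u → x ∸ K * rounded u x ≤ uDown K u
  ∸-*-rounded-≤-uDown u x x≤u with ≤-total (uUp K u) (x / K)
  ... | inj₁ U≤x/K rewrite m≤n⇒m⊓n≡m U≤x/K = ∸-monoˡ-≤ (K * uUp K u) x≤u
  ... | inj₂ x/K≤U rewrite m≥n⇒m⊓n≡n x/K≤U =
    ≤-uDown (≤-trans (m∸n≤m x (K * (x / K))) x≤u) (≤-trans (<⇒≤ remainder<K) (m≤n*m K 8))
    where
    remainder<K : x ∸ K * (x / K) < K
    remainder<K = m<n+o⇒m∸n<o x (K * (x / K)) (<-*-div-+ x 1≤K)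

  sum-recombine : ∀ {n} (s u x : Vector ℕ n) →
    sum (λ i → (K * rounded (u i) (x i) + (x i ∸ K * rounded (u i) (x i))) * s i) ≡ weight s x
  sum-recombine s u x = sum-cong-≗ λ i →
    trans (cong (_* s i) (m+[n∸m]≡n (*-rounded-≤ (u i) (x i)))) (*-comm (x i) (s i))

  rounded-error-sum : ∀ {n} (u x p : Vector ℕ n) → x ≤ᵥ u →
    sum (λ i → ∣ rounded (u i) (x i) - robustUp K (u i) (p i) ∣) * K
      ≤ 6 * sum (λ i → ∣ x i - p i ∣) + 5 * K * sum (λ i → partial (p i) (u i))
  rounded-error-sum u x p x≤u = begin
    sum (λ i → ∣ rounded (u i) (x i) - robustUp K (u i) (p i) ∣) * K
      ≡⟨ *-distribʳ-sum K (λ i → ∣ rounded (u i) (x i) - robustUp K (u i) (p i) ∣) ⟩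
    sum (λ i → ∣ rounded (u i) (x i) - robustUp K (u i) (p i) ∣ * K)
      ≤⟨ sum-mono-≤ (λ i → rounded-error-partial (u i) (x i) (p i) (x≤u i)) ⟩
    sum (λ i → 6 * ∣ x i - p i ∣ + 5 * K * partial (p i) (u i))
      ≡⟨ ∑-distrib-+ (λ i → 6 * ∣ x i - p i ∣) (λ i → 5 * K * partial (p i) (u i)) ⟩
    sum (λ i → 6 * ∣ x i - p i ∣) + sum (λ i → 5 * K * partial (p i) (u i))
      ≡⟨ cong₂ _+_ (*-distribˡ-sum 6 (λ i → ∣ x i - p i ∣)) (*-distribˡ-sum (5 * K) (λ i → partial (p i) (u i))) ⟨
    6 * sum (λ i → ∣ x i - p i ∣) + 5 * K * sum (λ i → partial (p i) (u i)) ∎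
    where open ≤-Reasoning

cbrt-≤ : ∀ m → cbrt m ≤ m
cbrt-≤ zero = z≤n
cbrt-≤ (suc m) with suc (cbrt m) ^ 3 ≤ᵇ suc m
... | true  = s≤s (cbrt-≤ m)
... | false = m≤n⇒m≤1+n (cbrt-≤ m)

cbrt[n]≤cbrt[1+n] : ∀ m → cbrt m ≤ cbrt (suc m)
cbrt[n]≤cbrt[1+n] m with suc (cbrt m) ^ 3 ≤ᵇ suc m
... | true  = n≤1+n (cbrt m)
... | false = ≤-refl

cbrt-pos : ∀ {m} → 1 ≤ m → 1 ≤ cbrt m
cbrt-pos {suc zero}    _ = s≤s z≤n
cbrt-pos {suc (suc m)} _ = ≤-trans (cbrt-pos {suc m} (s≤s z≤n)) (cbrt[n]≤cbrt[1+n] (suc m))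

robust-solution : ∀ {n} (s u : Vector ℕ n) (t K : ℕ) → 1 ≤ K → K ≤ maxF s →
  (∀ i → 1 ≤ s i) → 1 ≤ maxF s → InSubsetSums s u t →
  (σ : List (Fin n)) → σ ↭ allFin n →
  Σ (Vector ℕ n) λ xu → Σ (Vector ℕ n) λ xd →
    ((i : Fin n) → xu i ≤ uUp K (u i)) ×
    ((i : Fin n) → xd i ≤ uDown K (u i)) ×
    (sumF (λ i → (K * xu i + xd i) * s i) ≡ t) ×
    (sumF (λ i → ∣ xu i - robustUp K (u i) (prefixSol s u t σ i) ∣) * K ≤ 17 * maxF s)
robust-solution {n} s u t (suc k) _ K≤S s>0 1≤S (x , x≤u , Σsx≡t) σ σ↭ =
  xu , xd , (λ i → rounded-≤-uUp (u i) (x′ i)) , (λ i → ∸-*-rounded-≤-uDown (u i) (x′ i) (x′≤u i)) ,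
  recombine , bound
  where
  open Rounding k
  S = maxF s
  p = prefixSol s u t σ
  open PrefixSolution s u s>0
  σ! : Unique σ
  σ! = ↭allFin⇒Unique σ↭
  open Proximity s s>0 1≤S (≤maxF s) (prefixSol-≤ t σ) (prefixSol-weight-≤ t σ σ!)
                 (prefixSol-maximal-↭ (≤maxF s) t σ↭)
  close = proximity x≤u (trans (sym (sumF≡sum (λ i → s i * x i))) Σsx≡t)
  x′ = proj₁ close
  x′≤u = proj₁ (proj₂ close)
  wx′≡t = proj₁ (proj₂ (proj₂ close))
  ‖x′-p‖≤2S = proj₂ (proj₂ (proj₂ close))
  xu xd : Vector ℕ n
  xu i = rounded (u i) (x′ i)
  xd i = x′ i ∸ K * xu i
  recombine : sumF (λ i → (K * xu i + xd i) * s i) ≡ t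
  recombine = trans (sumF≡sum (λ i → (K * xu i + xd i) * s i)) (trans (sum-recombine s u x′) wx′≡t)
  bound : sumF (λ i → ∣ xu i - robustUp K (u i) (p i) ∣) * K ≤ 17 * S
  bound = begin
    sumF (λ i → ∣ xu i - robustUp K (u i) (p i) ∣) * K
      ≡⟨ cong (_* K) (sumF≡sum (λ i → ∣ xu i - robustUp K (u i) (p i) ∣)) ⟩
    sum (λ i → ∣ xu i - robustUp K (u i) (p i) ∣) * K
      ≤⟨ rounded-error-sum u x′ p x′≤u ⟩
    6 * sum (λ i → ∣ x′ i - p i ∣) + 5 * K * sum (λ i → partial (p i) (u i))
      ≤⟨ +-mono-≤ (*-monoʳ-≤ 6 ‖x′-p‖≤2S) (*-monoʳ-≤ (5 * K) (prefixSol-partial t σ σ!)) ⟩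
    6 * (S + S) + 5 * K * 1
      ≤⟨ +-monoʳ-≤ (6 * (S + S)) (≤-trans (≤-reflexive (*-identityʳ (5 * K))) (*-monoʳ-≤ 5 K≤S)) ⟩
    6 * (S + S) + 5 * S
      ≡⟨ 6[S+S]+5S≡17S S ⟩
    17 * S ∎
    where
    open ≤-Reasoning
    6[S+S]+5S≡17S : ∀ S → 6 * (S + S) + 5 * S ≡ 17 * S
    6[S+S]+5S≡17S = solve-∀

lemma13 : Σ ℕ λ C →
    (n : ℕ) (s u : Fin n → ℕ) (t : ℕ) →
    ((i : Fin n) → 1 ≤ s i) →
    InSubsetSums s u t →
    (σ : List (Fin n)) → σ ↭ allFin n →
    Σ (Fin n → ℕ) λ xu → Σ (Fin n → ℕ) λ xd →
      ((i : Fin n) → xu i ≤ uUp (cbrt (maxF s)) (u i)) ×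
      ((i : Fin n) → xd i ≤ uDown (cbrt (maxF s)) (u i)) ×
      (sumF (λ i → (cbrt (maxF s) * xu i + xd i) * s i) ≡ t) ×
      (sumF (λ i → ∣ xu i - robustUp (cbrt (maxF s)) (u i) (prefixSol s u t σ i) ∣)
         * cbrt (maxF s) ≤ C * maxF s)
lemma13 = 17 , λ where
  zero    s u t _   (_ , _ , Σsx≡t) σ _ → (λ ()) , (λ ()) , (λ ()) , (λ ()) , Σsx≡t , z≤n
  (suc n) s u t s>0 solvable σ σ↭ →
    let 1≤S = ≤-trans (s>0 Fin.zero) (≤maxF s Fin.zero)
    in robust-solution s u t (cbrt (maxF s)) (cbrt-pos 1≤S) (cbrt-≤ (maxF s)) s>0 1≤S solvable σ σ↭
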